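{- Let $G=(V,E)$ be a hedgegraph with hedgegraph polymatroid $f:2^E\to\mathbb{Z}_{\ge0}$. A subset $Q\subseteq E$ is a quotient of $f$ if and only if $Q=\delta(\mathcal{P})$ for some partition $\mathcal{P}$ of $V$.
   Context: A hedgegraph $G=(V,E)$ consists of a finite vertex set $V$ and a finite set $E$ of hedges; each hedge is a set of hyperedges (subsets of $V$), the hyperedges within one hedge are pairwise vertex-disjoint, and no hyperedge belongs to two hedges. For $A\subseteq E$, $\#\mathrm{Comps}(V,A)$ is the number of connected components of the hypergraph on $V$ formed by all hyperedges of hedges in $A$, and $f(A)=|V|-\#\mathrm{Comps}(V,A)$. For a partition $\mathcal{P}$ of $V$ into nonempty parts, $\delta(\mathcal{P})$ is the set of hedges containing a hyperedge intersecting at least two parts. For a polymatroid $f$ on ground set $\mathcal{N}$ and $S\subseteq\mathcal{N}$, $\mathrm{span}(S)=\{e\in\mathcal{N}: f(S\cup\{e\})=f(S)\}$; a set $Q\subseteq\mathcal{N}$ is a quotient of $f$ if $Q=\mathcal{N}\setminus\mathrm{span}(S)$ for some $S\subseteq\mathcal{N}$. -}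

module Defs where

open import Data.Nat using (ℕ; _∸_)
open import Data.Fin using (Fin)
open import Data.Fin.Subset using (Subset; _∈_; _∉_; _∩_; _∪_; ⁅_⁆; Empty)
open import Data.List using (List)
import Data.List.Membership.Propositional as LM
open import Data.List.Relation.Unary.AllPairs using (AllPairs)
open import Data.Product using (Σ; ∃; ∃-syntax; _×_)
open import Relation.Binary.PropositionalEquality using (_≡_; _≢_)
open import Relation.Binary.Construct.Closure.ReflexiveTransitive using (Star)
open import Relation.Nullary using (¬_)
open import Function.Bundles using (_⇔_)

-- Vertex set V = Fin n, hedge set E = Fin m.
-- Each hedge is a finite collection (list) of hyperedges, each hyperedge a subset of V.
record Hedgegraph (n m : ℕ) : Set where
  field
    hyperedges : Fin m → List (Subset n)
    disjoint   : ∀ e → AllPairs (λ H H′ → Empty (H ∩ H′)) (hyperedges e)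
    noShare    : ∀ e e′ H → H LM.∈ hyperedges e → H LM.∈ hyperedges e′ → e ≡ e′

module _ {n m : ℕ} (G : Hedgegraph n m) where
  open Hedgegraph G

  Adj : Subset m → Fin n → Fin n → Set
  Adj A u v = ∃[ e ] (e ∈ A × ∃[ H ] (H LM.∈ hyperedges e × u ∈ H × v ∈ H))

  Connected : Subset m → Fin n → Fin n → Set
  Connected A = Star (Adj A)

  -- #Comps(V,A) = k : the connected components are exactly the fibres of a
  -- surjection c : V → Fin k
  NumComps : Subset m → ℕ → Set
  NumComps A k = Σ (Fin n → Fin k) λ c →
    (∀ i → ∃[ u ] (c u ≡ i)) × (∀ u v → (c u ≡ c v) ⇔ Connected A u v)

  -- f(A) = r, where f(A) = |V| - #Comps(V,A)
  Rank : Subset m → ℕ → Set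
  Rank A r = ∃[ k ] (NumComps A k × r ≡ n ∸ k)

  InSpan : Subset m → Fin m → Set
  InSpan S e = ∃[ r ] (Rank S r × Rank (S ∪ ⁅ e ⁆) r)

  IsQuotient : Subset m → Set
  IsQuotient Q = ∃[ S ] (∀ e → (e ∈ Q) ⇔ (¬ InSpan S e))

  -- a partition of V into k nonempty parts, given by a surjective labelling
  IsPartition : {k : ℕ} → (Fin n → Fin k) → Set
  IsPartition {k} p = ∀ i → ∃[ u ] (p u ≡ i)

  InDelta : {k : ℕ} → (Fin n → Fin k) → Fin m → Set
  InDelta p e = ∃[ H ] (H LM.∈ hyperedges e × ∃[ u ] ∃[ v ] (u ∈ H × v ∈ H × p u ≢ p v))

-- The connected components of S form a partition c of V. Adding a hedge e to S can only merge
-- components, and a coarsening onto the same number of parts changes nothing, so e ∈ span(S)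
-- exactly when every hyperedge of e lies inside one component of S, i.e. when e ∉ δ(c).
-- Hence E ∖ span(S) = δ(c). Conversely, for Q = δ(P) take S = E ∖ Q: every hedge of S lies inside
-- a part of P, so components of S refine P; every hedge of Q has a hyperedge meeting two parts,
-- hence two components of S, so E ∖ span(S) = Q.
module Submission where

open import Defs
open import Level using (0ℓ)
open import Data.Nat using (ℕ; zero; suc; _≤_; _∸_)
open import Data.Nat.Properties using (∸-cancelˡ-≡; 1+n≰n)
open import Data.Fin using (Fin; zero; suc; punchOut)
open import Data.Fin.Properties using (any?; punchOut-injective; injective⇒≤; suc-injective)
  renaming (_≟_ to _≟ᶠ_)
open import Data.Fin.Subset using (Subset; _∈_; _⊆_; _∪_; ⁅_⁆; ∁)
open import Data.Fin.Subset.Properties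
  using (_∈?_; x∈⁅x⁆; x∈⁅y⁆⇒x≡y; x∈p∪q⁻; p⊆p∪q; q⊆p∪q; x∉p⇒x∈∁p; x∈∁p⇒x∉p)
open import Data.List using (List; []; _∷_; concatMap; filter; allFin)
open import Data.List.Membership.Propositional using (find; lose) renaming (_∈_ to _∈ₗ_)
open import Data.List.Membership.Propositional.Properties
  using (∈-concatMap⁺; ∈-concatMap⁻; ∈-filter⁺; ∈-filter⁻; ∈-allFin)
open import Data.List.Relation.Unary.Any using (here; there)
import Data.List.Relation.Unary.Any as Any
open import Data.Product using (Σ; ∃-syntax; _×_; _,_; proj₁; proj₂)
open import Data.Sum using (_⊎_; inj₁; inj₂)
open import Relation.Nullary using (¬_; Dec; yes; no; contradiction)
open import Relation.Nullary.Decidable using (_×-dec_; _⊎-dec_; ¬?; map′; decidable-stable)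
open import Relation.Binary using (Rel; IsDecEquivalence)
open import Relation.Binary.PropositionalEquality using (_≡_; _≢_; refl; sym; trans; cong)
open import Relation.Binary.Construct.Closure.ReflexiveTransitive using (Star; ε; _◅_; _◅◅_)
import Relation.Binary.Construct.Closure.ReflexiveTransitive as Star
open import Function using (id)
open import Function.Bundles using (_⇔_; mk⇔; Equivalence)
open import Function.Definitions using (Injective; StrictlySurjective)

open import Function.Properties.Equivalence using () renaming (trans to ⇔-trans; sym to ⇔-sym)

open Equivalence using (to; from)

module _ {n k : ℕ} {c : Fin n → Fin k} (surj : StrictlySurjective _≡_ c) where

  section : Fin k → Fin n
  section j = proj₁ (surj j)

  c∘section : ∀ j → c (section j) ≡ j
  c∘section j = proj₂ (surj j)

  section-injective : Injective _≡_ _≡_ section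
  section-injective {i} {j} eq = trans (sym (c∘section i)) (trans (cong c eq) (c∘section j))

  strictlySurjective⇒≥ : k ≤ n
  strictlySurjective⇒≥ = injective⇒≤ section-injective

injective⇒strictlySurjective : ∀ {k} {f : Fin k → Fin k} →
  Injective _≡_ _≡_ f → StrictlySurjective _≡_ f
injective⇒strictlySurjective {suc k} {f} inj j with any? (λ i → f i ≟ᶠ j)
... | yes hit = hit
... | no miss = contradiction (injective⇒≤ punchOut-inj) 1+n≰n
  where
  f≢j : ∀ i → j ≢ f i
  f≢j i eq = miss (i , sym eq)
  punchOut-inj : Injective _≡_ _≡_ (λ i → punchOut (f≢j i))
  punchOut-inj eq = inj (punchOut-injective (f≢j _) (f≢j _) eq)

strictlySurjective⇒injective : ∀ {k} {g : Fin k → Fin k} →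
  StrictlySurjective _≡_ g → Injective _≡_ _≡_ g
strictlySurjective⇒injective {k} {g} surj {a} {b} ga≡gb =
  trans (sym (s∘g a)) (trans (cong s ga≡gb) (s∘g b))
  where
  s : Fin k → Fin k
  s = section surj
  s∘g : ∀ x → s (g x) ≡ x
  s∘g x with injective⇒strictlySurjective (section-injective surj) x
  ... | x′ , refl = cong s (c∘section surj x′)

-- c′ factors as g ∘ c with g : Fin k → Fin k onto, hence injective.
same-size-coarsening-reflects-kernel : ∀ {n k} {c c′ : Fin n → Fin k} →
  StrictlySurjective _≡_ c → StrictlySurjective _≡_ c′ →
  (∀ {u v} → c u ≡ c v → c′ u ≡ c′ v) → ∀ {u v} → c′ u ≡ c′ v → c u ≡ c v
same-size-coarsening-reflects-kernel {k = k} {c} {c′} surj surj′ coarser {u} {v} c′u≡c′v =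
  strictlySurjective⇒injective g-surjective
    (trans (g∘c u) (trans c′u≡c′v (sym (g∘c v))))
  where
  g : Fin k → Fin k
  g i = c′ (section surj i)
  g∘c : ∀ x → g (c x) ≡ c′ x
  g∘c x = coarser (c∘section surj (c x))
  g-surjective : StrictlySurjective _≡_ g
  g-surjective j with surj′ j
  ... | x , c′x≡j = c x , trans (g∘c x) c′x≡j

module _ {n : ℕ} where

  Classifies : ∀ {k} → (Fin n → Fin k) → Rel (Fin n) 0ℓ → Set
  Classifies c R = StrictlySurjective _≡_ c × (∀ u v → (c u ≡ c v) ⇔ R u v)

  Classification : Rel (Fin n) 0ℓ → Set
  Classification R = ∃[ k ] Σ (Fin n → Fin k) λ c → Classifies c R

  classifies-resp-⇔ : ∀ {k} {c : Fin n → Fin k} {R S : Rel (Fin n) 0ℓ} →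
    (∀ {u v} → R u v ⇔ S u v) → Classifies c R → Classifies c S
  classifies-resp-⇔ R⇔S (surj , ker) =
    surj , λ u v → mk⇔ (λ eq → to R⇔S (to (ker u v) eq)) (λ s → from (ker u v) (from R⇔S s))

  classification-resp-⇔ : ∀ {R S : Rel (Fin n) 0ℓ} → (∀ {u v} → R u v ⇔ S u v) →
    Classification R → Classification S
  classification-resp-⇔ R⇔S (k , c , classifies) = k , c , classifies-resp-⇔ R⇔S classifies

module _ {n : ℕ} {R : Rel (Fin (suc n)) 0ℓ} (isDecEq : IsDecEquivalence R) where
  open IsDecEquivalence isDecEq renaming (refl to R-refl; sym to R-sym; trans to R-trans)

  Rₛ : Rel (Fin n) 0ℓ
  Rₛ u v = R (suc u) (suc v)

  restriction-isDecEquivalence : IsDecEquivalence Rₛ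
  restriction-isDecEquivalence = record
    { isEquivalence = record { refl = R-refl ; sym = R-sym ; trans = R-trans }
    ; _≟_ = λ u v → suc u ≟ suc v
    }

  classify-joining : ∀ {v₀} → R zero (suc v₀) → Classification Rₛ → Classification R
  classify-joining {v₀} 0~v₀ (k , c , surj , ker) = k , c₀ , surj₀ , ker₀
    where
    c₀ : Fin (suc n) → Fin k
    c₀ zero = c v₀
    c₀ (suc v) = c v
    surj₀ : StrictlySurjective _≡_ c₀
    surj₀ i with surj i
    ... | u , cu≡i = suc u , cu≡i
    ker₀ : ∀ u v → (c₀ u ≡ c₀ v) ⇔ R u v
    ker₀ zero zero = mk⇔ (λ _ → R-refl) (λ _ → refl)
    ker₀ zero (suc v) =
      mk⇔ (λ eq → R-trans 0~v₀ (to (ker v₀ v) eq)) (λ r → from (ker v₀ v) (R-trans (R-sym 0~v₀) r))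
    ker₀ (suc u) zero =
      mk⇔ (λ eq → R-trans (to (ker u v₀) eq) (R-sym 0~v₀)) (λ r → from (ker u v₀) (R-trans r 0~v₀))
    ker₀ (suc u) (suc v) = ker u v

  classify-isolated : (∀ v → ¬ R zero (suc v)) → Classification Rₛ → Classification R
  classify-isolated isolated (k , c , surj , ker) = suc k , c₀ , surj₀ , ker₀
    where
    c₀ : Fin (suc n) → Fin (suc k)
    c₀ zero = zero
    c₀ (suc v) = suc (c v)
    surj₀ : StrictlySurjective _≡_ c₀
    surj₀ zero = zero , refl
    surj₀ (suc i) with surj i
    ... | u , cu≡i = suc u , cong suc cu≡i
    ker₀ : ∀ u v → (c₀ u ≡ c₀ v) ⇔ R u v
    ker₀ zero zero = mk⇔ (λ _ → R-refl) (λ _ → refl)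
    ker₀ zero (suc v) = mk⇔ (λ ()) (λ r → contradiction r (isolated v))
    ker₀ (suc u) zero = mk⇔ (λ ()) (λ r → contradiction (R-sym r) (isolated u))
    ker₀ (suc u) (suc v) =
      mk⇔ (λ eq → to (ker u v) (suc-injective eq)) (λ r → cong suc (from (ker u v) r))

classify : ∀ {n} {R : Rel (Fin n) 0ℓ} → IsDecEquivalence R → Classification R
classify {zero} _ = zero , (λ ()) , (λ ()) , (λ ())
classify {suc n} isDecEq with any? (λ v → IsDecEquivalence._≟_ isDecEq zero (suc v))
... | yes (_ , 0~v₀) =
  classify-joining isDecEq 0~v₀ (classify (restriction-isDecEquivalence isDecEq))
... | no ¬joins =
  classify-isolated isDecEq (λ v r → ¬joins (v , r)) (classify (restriction-isDecEquivalence isDecEq))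

module _ {n : ℕ} where

  Linked : List (Subset n) → Rel (Fin n) 0ℓ
  Linked Hs u v = ∃[ H ] (H ∈ₗ Hs × u ∈ H × v ∈ H)

  -- Adding H to Hs merges all the components that meet H into one.
  module AddHyperedge (H : Subset n) (Hs : List (Subset n)) {k : ℕ} (c : Fin n → Fin k)
                      (ker : ∀ u v → (c u ≡ c v) ⇔ Star (Linked Hs) u v) where

    Meets : Fin n → Set
    Meets u = ∃[ a ] (a ∈ H × c a ≡ c u)

    Merged : Rel (Fin n) 0ℓ
    Merged u v = c u ≡ c v ⊎ (Meets u × Meets v)

    meets? : ∀ u → Dec (Meets u)
    meets? u = any? λ a → (a ∈? H) ×-dec (c a ≟ᶠ c u)

    merged-trans : ∀ {u v w} → Merged u v → Merged v w → Merged u w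
    merged-trans (inj₁ eq) (inj₁ eq′) = inj₁ (trans eq eq′)
    merged-trans (inj₁ eq) (inj₂ ((a , a∈H , ca≡cv) , meets-w)) =
      inj₂ ((a , a∈H , trans ca≡cv (sym eq)) , meets-w)
    merged-trans (inj₂ (meets-u , (a , a∈H , ca≡cv))) (inj₁ eq) =
      inj₂ (meets-u , (a , a∈H , trans ca≡cv eq))
    merged-trans (inj₂ (meets-u , _)) (inj₂ (_ , meets-w)) = inj₂ (meets-u , meets-w)

    merged-isDecEquivalence : IsDecEquivalence Merged
    merged-isDecEquivalence = record
      { isEquivalence = record
        { refl = inj₁ refl
        ; sym = λ { (inj₁ eq) → inj₁ (sym eq) ; (inj₂ (mu , mv)) → inj₂ (mv , mu) }
        ; trans = merged-trans
        }
      ; _≟_ = λ u v → (c u ≟ᶠ c v) ⊎-dec (meets? u ×-dec meets? v)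
      }

    weaken : ∀ {u v} → Star (Linked Hs) u v → Star (Linked (H ∷ Hs)) u v
    weaken = Star.map λ (H′ , H′∈Hs , u∈H′ , v∈H′) → H′ , there H′∈Hs , u∈H′ , v∈H′

    merged⇒connected : ∀ {u v} → Merged u v → Star (Linked (H ∷ Hs)) u v
    merged⇒connected {u} {v} (inj₁ eq) = weaken (to (ker u v) eq)
    merged⇒connected {u} {v} (inj₂ ((a , a∈H , ca≡cu) , (b , b∈H , cb≡cv))) =
      weaken (to (ker u a) (sym ca≡cu))
        ◅◅ ((H , here refl , a∈H , b∈H) ◅ weaken (to (ker b v) cb≡cv))

    linked⇒merged : ∀ {u v} → Linked (H ∷ Hs) u v → Merged u v
    linked⇒merged {u} {v} (_ , here refl , u∈H , v∈H) = inj₂ ((u , u∈H , refl) , (v , v∈H , refl))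
    linked⇒merged {u} {v} (H′ , there H′∈Hs , u∈H′ , v∈H′) =
      inj₁ (from (ker u v) ((H′ , H′∈Hs , u∈H′ , v∈H′) ◅ ε))

    connected⇒merged : ∀ {u v} → Star (Linked (H ∷ Hs)) u v → Merged u v
    connected⇒merged ε = inj₁ refl
    connected⇒merged (step ◅ steps) = merged-trans (linked⇒merged step) (connected⇒merged steps)

  linked-[]⇒≡ : ∀ {u v} → Star (Linked []) u v → u ≡ v
  linked-[]⇒≡ ε = refl
  linked-[]⇒≡ ((_ , () , _) ◅ _)

  components : (Hs : List (Subset n)) → Classification (Star (Linked Hs))
  components [] = n , id , (λ i → i , refl) , λ u v → mk⇔ (λ { refl → ε }) linked-[]⇒≡
  components (H ∷ Hs) with components Hs
  ... | _ , c , _ , ker = classification-resp-⇔ (mk⇔ merged⇒connected connected⇒merged)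
                            (classify merged-isDecEquivalence)
    where open AddHyperedge H Hs c ker

module _ {n m : ℕ} (G : Hedgegraph n m) where
  open Hedgegraph G

  hyperedgesIn : Subset m → List (Subset n)
  hyperedgesIn A = concatMap hyperedges (filter (_∈? A) (allFin m))

  linked⇒adj : ∀ {A u v} → Linked (hyperedgesIn A) u v → Adj G A u v
  linked⇒adj {A} (H , H∈A , u∈H , v∈H)
    with find (∈-concatMap⁻ hyperedges {xs = filter (_∈? A) (allFin m)} H∈A)
  ... | e , e∈A , H∈e = e , proj₂ (∈-filter⁻ (_∈? A) {xs = allFin m} e∈A) , H , H∈e , u∈H , v∈H

  adj⇒linked : ∀ {A u v} → Adj G A u v → Linked (hyperedgesIn A) u v
  adj⇒linked {A} (e , e∈A , H , H∈e , u∈H , v∈H) =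
    H , ∈-concatMap⁺ hyperedges (lose (∈-filter⁺ (_∈? A) (∈-allFin e) e∈A) H∈e) , u∈H , v∈H

  -- NumComps G A k unfolds to Σ c (Classifies c (Connected G A)).
  numComps : ∀ A → ∃[ k ] NumComps G A k
  numComps A = classification-resp-⇔ (mk⇔ (Star.map linked⇒adj) (Star.map adj⇒linked))
                 (components (hyperedgesIn A))

  connected-mono : ∀ {A B} → A ⊆ B → ∀ {u v} → Connected G A u v → Connected G B u v
  connected-mono A⊆B = Star.map λ (e , e∈A , linked) → e , A⊆B e∈A , linked

  numComps-unique : ∀ {A B k k′} → NumComps G A k → NumComps G B k′ → n ∸ k ≡ n ∸ k′ → k ≡ k′
  numComps-unique (_ , surj , _) (_ , surj′ , _) =
    ∸-cancelˡ-≡ (strictlySurjective⇒≥ surj) (strictlySurjective⇒≥ surj′)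

  WithinComponents : Subset m → Fin m → Set
  WithinComponents S e =
    ∀ {H} → H ∈ₗ hyperedges e → ∀ {u v} → u ∈ H → v ∈ H → Connected G S u v

  ∈⇒withinComponents : ∀ {S e} → e ∈ S → WithinComponents S e
  ∈⇒withinComponents e∈S H∈e u∈H v∈H = (_ , e∈S , _ , H∈e , u∈H , v∈H) ◅ ε

  withinComponents⇒∪-connected : ∀ {S e} → WithinComponents S e →
    ∀ {u v} → Connected G (S ∪ ⁅ e ⁆) u v → Connected G S u v
  withinComponents⇒∪-connected within ε = ε
  withinComponents⇒∪-connected {S} {e} within ((e′ , e′∈ , H , H∈e′ , u∈H , v∈H) ◅ steps)
    with x∈p∪q⁻ S ⁅ e ⁆ e′∈
  ... | inj₁ e′∈S = (e′ , e′∈S , H , H∈e′ , u∈H , v∈H) ◅ withinComponents⇒∪-connected within steps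
  ... | inj₂ e′∈⁅e⁆ with x∈⁅y⁆⇒x≡y e e′∈⁅e⁆
  ...   | refl = within H∈e′ u∈H v∈H ◅◅ withinComponents⇒∪-connected within steps

  sameNumComps⇒withinComponents : ∀ {S e k} → NumComps G S k → NumComps G (S ∪ ⁅ e ⁆) k →
    WithinComponents S e
  sameNumComps⇒withinComponents {S} {e} (c , surj , ker) (c′ , surj′ , ker′)
                                {H} H∈e {u} {v} u∈H v∈H =
    to (ker u v) (same-size-coarsening-reflects-kernel surj surj′ coarser c′u≡c′v)
    where
    coarser : ∀ {x y} → c x ≡ c y → c′ x ≡ c′ y
    coarser {x} {y} eq = from (ker′ x y) (connected-mono (p⊆p∪q ⁅ e ⁆) (to (ker x y) eq))
    c′u≡c′v : c′ u ≡ c′ v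
    c′u≡c′v = from (ker′ u v) ((e , q⊆p∪q S ⁅ e ⁆ (x∈⁅x⁆ e) , H , H∈e , u∈H , v∈H) ◅ ε)

  inSpan⇔withinComponents : ∀ {S e} → InSpan G S e ⇔ WithinComponents S e
  inSpan⇔withinComponents {S} {e} = mk⇔ inSpan⇒within within⇒inSpan
    where
    inSpan⇒within : InSpan G S e → WithinComponents S e
    inSpan⇒within (_ , (k , comps , r≡) , (k′ , comps′ , r≡′))
      with numComps-unique comps comps′ (trans (sym r≡) r≡′)
    ... | refl = sameNumComps⇒withinComponents comps comps′
    within⇒inSpan : WithinComponents S e → InSpan G S e
    within⇒inSpan within with numComps S
    ... | k , c , classifies =
      n ∸ k , (k , (c , classifies) , refl) , (k , (c , classifies-resp-⇔ same classifies) , refl)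
      where
      same : ∀ {u v} → Connected G S u v ⇔ Connected G (S ∪ ⁅ e ⁆) u v
      same = mk⇔ (connected-mono (p⊆p∪q ⁅ e ⁆)) (withinComponents⇒∪-connected within)

  inDelta? : ∀ {k} (p : Fin n → Fin k) e → Dec (InDelta G p e)
  inDelta? p e = map′ find (λ (H , H∈e , cut) → lose H∈e cut) (Any.any? cut? (hyperedges e))
    where
    cut? : ∀ H → Dec (∃[ u ] ∃[ v ] (u ∈ H × v ∈ H × p u ≢ p v))
    cut? H = any? λ u → any? λ v → (u ∈? H) ×-dec (v ∈? H) ×-dec ¬? (p u ≟ᶠ p v)

  ¬inDelta⇒constant : ∀ {k} (p : Fin n → Fin k) {e} → ¬ InDelta G p e →
    ∀ {H} → H ∈ₗ hyperedges e → ∀ {u v} → u ∈ H → v ∈ H → p u ≡ p v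
  ¬inDelta⇒constant p ¬cut {H} H∈e {u} {v} u∈H v∈H =
    decidable-stable (p u ≟ᶠ p v) λ pu≢pv → ¬cut (H , H∈e , u , v , u∈H , v∈H , pu≢pv)

  inDelta⇔¬inSpan : ∀ {S e k} {c : Fin n → Fin k} → Classifies c (Connected G S) →
    InDelta G c e ⇔ (¬ InSpan G S e)
  inDelta⇔¬inSpan {S} {e} {c = c} (_ , ker) = mk⇔ cut⇒¬inSpan ¬inSpan⇒cut
    where
    cut⇒¬inSpan : InDelta G c e → ¬ InSpan G S e
    cut⇒¬inSpan (H , H∈e , u , v , u∈H , v∈H , cu≢cv) inSpan =
      cu≢cv (from (ker u v) (to inSpan⇔withinComponents inSpan H∈e u∈H v∈H))
    ¬inSpan⇒cut : ¬ InSpan G S e → InDelta G c e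
    ¬inSpan⇒cut ¬inSpan = decidable-stable (inDelta? c e) λ ¬cut →
      ¬inSpan (from inSpan⇔withinComponents λ H∈e u∈H v∈H →
        to (ker _ _) (¬inDelta⇒constant c ¬cut H∈e u∈H v∈H))

  connected⇒samePart : ∀ {S k} (p : Fin n → Fin k) → (∀ {e} → e ∈ S → ¬ InDelta G p e) →
    ∀ {u v} → Connected G S u v → p u ≡ p v
  connected⇒samePart p uncut ε = refl
  connected⇒samePart p uncut ((_ , e∈S , _ , H∈e , u∈H , v∈H) ◅ steps) =
    trans (¬inDelta⇒constant p (uncut e∈S) H∈e u∈H v∈H) (connected⇒samePart p uncut steps)

  quotient⇒delta : ∀ {Q} → IsQuotient G Q →
    ∃[ k ] Σ (Fin n → Fin k) λ p → IsPartition G p × (∀ e → (e ∈ Q) ⇔ InDelta G p e)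
  quotient⇒delta (S , Q⇔¬inSpan) with numComps S
  ... | k , c , classifies@(surj , _) =
    k , c , surj , λ e → ⇔-trans (Q⇔¬inSpan e) (⇔-sym (inDelta⇔¬inSpan classifies))

  -- The span witness is S = E ∖ Q.
  delta⇒quotient : ∀ {Q k} (p : Fin n → Fin k) → (∀ e → (e ∈ Q) ⇔ InDelta G p e) →
    IsQuotient G Q
  delta⇒quotient {Q} p Q⇔cut = ∁ Q , λ e → mk⇔ (∈Q⇒¬inSpan e) (¬inSpan⇒∈Q e)
    where
    samePart : ∀ {u v} → Connected G (∁ Q) u v → p u ≡ p v
    samePart = connected⇒samePart p λ e∈∁Q cut → x∈∁p⇒x∉p e∈∁Q (from (Q⇔cut _) cut)
    ∈Q⇒¬inSpan : ∀ e → e ∈ Q → ¬ InSpan G (∁ Q) e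
    ∈Q⇒¬inSpan e e∈Q inSpan with to (Q⇔cut e) e∈Q
    ... | H , H∈e , u , v , u∈H , v∈H , pu≢pv =
      pu≢pv (samePart (to inSpan⇔withinComponents inSpan H∈e u∈H v∈H))
    ¬inSpan⇒∈Q : ∀ e → ¬ InSpan G (∁ Q) e → e ∈ Q
    ¬inSpan⇒∈Q e ¬inSpan = decidable-stable (e ∈? Q) λ e∉Q →
      ¬inSpan (from inSpan⇔withinComponents (∈⇒withinComponents (x∉p⇒x∈∁p e∉Q)))

lemma6p2 : ∀ {n m : ℕ} (G : Hedgegraph n m) (Q : Subset m) →
    IsQuotient G Q ⇔
      (∃[ k ] Σ (Fin n → Fin k) λ p →
        IsPartition G p × (∀ e → (e ∈ Q) ⇔ InDelta G p e))
lemma6p2 G Q = mk⇔ (quotient⇒delta G) λ (_ , p , _ , Q⇔cut) → delta⇒quotient G p Q⇔cut
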